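{- Let $p,q$ be complex numbers with $p^2-4q\neq0$ and let $k$ be a positive integer with $V_k^2(p,q)-4q^k\neq0$. Write $U_m=U_m(p,q)$, $V_m=V_m(p,q)$. Then: (i) For every $n\ge3$, $$s_4(n;p,q;k)=\frac{U_k^3}{6(V_k^2-4q^k)^3}\Big(V_k^3(n-1)(n-2)(n-3)U_{nk}-6q^kV_k^2(n-2)(n-3)(n+1)U_{(n-1)k}$$ $$+12q^{2k}V_k(n-3)(n^2+n-1)U_{(n-2)k}-8q^{3k}n(n^2-4)U_{(n-3)k}\Big).$$ (ii) For every $n\ge4$, $$s_5(n;p,q;k)=\frac{U_k^4}{4!(V_k^2-4q^k)^4}\Big(V_k^4(n-1)(n-2)(n-3)(n-4)U_{nk}-4q^kV_k^3(n-2)(n-3)(n-4)(2n+3)U_{(n-1)k}$$ $$+12q^{2k}V_k^2(n-3)(n-4)(2n^2+4n-1)U_{(n-2)k}-8q^{3k}V_k(n-4)(2n+1)(2n^2+2n-9)U_{(n-3)k}$$ $$+16q^{4k}(n-3)(n-1)(n+1)(n+3)U_{(n-4)k}\Big).$$ (iii) For every $n\ge5$, $$s_6(n;p,q;k)=\frac{U_k^5}{5!(V_k^2-4q^k)^5}\Big(V_k^5(n-1)(n-2)(n-3)(n-4)(n-5)U_{nk}-10q^kV_k^4(n-2)(n-3)(n-4)(n-5)(n+2)U_{(n-1)k}$$ $$+20q^{2k}V_k^3(n-3)(n-4)(n-5)(2n^2+6n+1)U_{(n-2)k}-40q^{3k}V_k^2(n-4)(n-5)(n+1)(2n^2+4n-9)U_{(n-3)k}$$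 $$+80q^{4k}V_k(n-5)(n^4+2n^3-10n^2-11n+9)U_{(n-4)k}-32q^{5k}n(n-4)(n-2)(n+2)(n+4)U_{(n-5)k}\Big).$$
   Context: For complex $p,q$ with $p^2-4q\ne0$, put $\alpha=\frac12(p+\sqrt{p^2-4q})$, $\beta=\frac12(p-\sqrt{p^2-4q})$, and for $n\ge0$ define $U_n(p,q)=\frac{\alpha^n-\beta^n}{\alpha-\beta}$ and $V_n(p,q)=\alpha^n+\beta^n$. For integers $d\ge1$, $n\ge0$ and positive integer $k$ define $$s_d(n;p,q;k)=\sum_{\substack{j_1+\cdots+j_d=n\\ j_1,\dots,j_d\ge0}}\ \prod_{i=1}^{d}U_{k j_i}(p,q).$$ -}

module Defs where

open import Level using (Level)
open import Data.Nat as ℕ using (ℕ; zero; suc; _∸_; _≤_)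
open import Algebra.Bundles using (CommutativeRing)
open import Level using (_⊔_)
open import Data.Product using (_×_)

-- Lucas sequences and the convolution sums s_d, over an arbitrary
-- commutative ring R, expressed through the roots α, β of x² - p x + q
-- (so p = α + β, q = α β) and a given inverse w of (α - β).
module Lucas {c ℓ : Level} (R : CommutativeRing c ℓ) where
  open CommutativeRing R

  infixl 6 _⊖_
  _⊖_ : Carrier → Carrier → Carrier
  x ⊖ y = x + (- y)

  pow : Carrier → ℕ → Carrier
  pow x zero    = 1#
  pow x (suc n) = x * pow x n

  ι : ℕ → Carrier
  ι zero    = 0#
  ι (suc n) = 1# + ι n

  P : Carrier → Carrier → Carrier
  P α β = α + β

  Q : Carrier → Carrier → Carrier
  Q α β = α * β

  -- U_n = (α^n - β^n) / (α - β), where w is the inverse of α - β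
  U : (α β w : Carrier) → ℕ → Carrier
  U α β w n = w * (pow α n - pow β n)

  V : (α β : Carrier) → ℕ → Carrier
  V α β n = pow α n + pow β n

  Σ≤ : ℕ → (ℕ → Carrier) → Carrier
  Σ≤ zero    f = f 0
  Σ≤ (suc n) f = Σ≤ n f + f (suc n)

  -- s_d(n;p,q;k) = Σ_{j_1+…+j_d = n} Π_i U_{k j_i}, by recursion on d
  -- (s_0(n) is the empty-product sum: 1 if n = 0, else 0)
  s : (α β w : Carrier) → (d n k : ℕ) → Carrier
  s α β w zero    zero    k = 1#
  s α β w zero    (suc n) k = 0#
  s α β w (suc d) n       k = Σ≤ n (λ j → U α β w (k ℕ.* j) * s α β w d (n ∸ j) k)

  -- The statement of the theorem (parts (i), (ii), (iii)), with the
  -- divisions by (α - β), (V_k² - 4 q^k), 3!, 4!, 5! expressed through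
  -- given inverses w, e, i6, i24, i120.
  Theorem5 : Set (c ⊔ ℓ)
  Theorem5 =
      (α β w : Carrier) → w * (α ⊖ β) ≈ 1# →
      (k : ℕ) → 1 ≤ k →
      (e : Carrier) → e * (pow (V α β k) 2 ⊖ ι 4 * pow (Q α β) k) ≈ 1# →
      (i6 i24 i120 : Carrier) → i6 * ι 6 ≈ 1# → i24 * ι 24 ≈ 1# → i120 * ι 120 ≈ 1# →
      let Uk = U α β w k
          Vk = V α β k
          qk = pow (Q α β) k
          u  = λ (m : ℕ) → U α β w (m ℕ.* k)
      in
      (∀ (n : ℕ) → 3 ≤ n →
        let N = ι n in
        s α β w 4 n k ≈
          pow Uk 3 * i6 * pow e 3 *
            (pow Vk 3 * (N ⊖ ι 1) * (N ⊖ ι 2) * (N ⊖ ι 3) * u n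
             ⊖ ι 6 * qk * pow Vk 2 * (N ⊖ ι 2) * (N ⊖ ι 3) * (N + ι 1) * u (n ∸ 1)
             + ι 12 * pow qk 2 * Vk * (N ⊖ ι 3) * (pow N 2 + N ⊖ ι 1) * u (n ∸ 2)
             ⊖ ι 8 * pow qk 3 * N * (pow N 2 ⊖ ι 4) * u (n ∸ 3)))
      ×
      (∀ (n : ℕ) → 4 ≤ n →
        let N = ι n in
        s α β w 5 n k ≈
          pow Uk 4 * i24 * pow e 4 *
            (pow Vk 4 * (N ⊖ ι 1) * (N ⊖ ι 2) * (N ⊖ ι 3) * (N ⊖ ι 4) * u n
             ⊖ ι 4 * qk * pow Vk 3 * (N ⊖ ι 2) * (N ⊖ ι 3) * (N ⊖ ι 4) * (ι 2 * N + ι 3) * u (n ∸ 1)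
             + ι 12 * pow qk 2 * pow Vk 2 * (N ⊖ ι 3) * (N ⊖ ι 4) * (ι 2 * pow N 2 + ι 4 * N ⊖ ι 1) * u (n ∸ 2)
             ⊖ ι 8 * pow qk 3 * Vk * (N ⊖ ι 4) * (ι 2 * N + ι 1) * (ι 2 * pow N 2 + ι 2 * N ⊖ ι 9) * u (n ∸ 3)
             + ι 16 * pow qk 4 * (N ⊖ ι 3) * (N ⊖ ι 1) * (N + ι 1) * (N + ι 3) * u (n ∸ 4)))
      ×
      (∀ (n : ℕ) → 5 ≤ n →
        let N = ι n in
        s α β w 6 n k ≈
          pow Uk 5 * i120 * pow e 5 *
            (pow Vk 5 * (N ⊖ ι 1) * (N ⊖ ι 2) * (N ⊖ ι 3) * (N ⊖ ι 4) * (N ⊖ ι 5) * u n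
             ⊖ ι 10 * qk * pow Vk 4 * (N ⊖ ι 2) * (N ⊖ ι 3) * (N ⊖ ι 4) * (N ⊖ ι 5) * (N + ι 2) * u (n ∸ 1)
             + ι 20 * pow qk 2 * pow Vk 3 * (N ⊖ ι 3) * (N ⊖ ι 4) * (N ⊖ ι 5) * (ι 2 * pow N 2 + ι 6 * N + ι 1) * u (n ∸ 2)
             ⊖ ι 40 * pow qk 3 * pow Vk 2 * (N ⊖ ι 4) * (N ⊖ ι 5) * (N + ι 1) * (ι 2 * pow N 2 + ι 4 * N ⊖ ι 9) * u (n ∸ 3)
             + ι 80 * pow qk 4 * Vk * (N ⊖ ι 5) * (pow N 4 + ι 2 * pow N 3 ⊖ ι 10 * pow N 2 ⊖ ι 11 * N + ι 9) * u (n ∸ 4)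
             ⊖ ι 32 * pow qk 5 * N * (N ⊖ ι 4) * (N ⊖ ι 2) * (N + ι 2) * (N + ι 4) * u (n ∸ 5)))

-- Put f j = U_{jk}. Then s_{d+1} = f ⋆ s_d is a convolution, and since f obeys the Lucas recurrence
-- f (j+2) = V_k f (j+1) - q^k f j with f 0 = 0 and f 1 = U_k, the sums obey the inhomogeneous recurrence
-- s_{d+1}(n+2) = V_k s_{d+1}(n+1) - q^k s_{d+1}(n) + U_k s_d(n+1), with s_d(n) = 0 for n < d and s_d(d) = U_k^d.
-- By induction on d, (d-1)! D^{d-1} s_d(n) = U_k^{d-1} F_d(n) for n ≥ d - 1, where D = V_k² - 4 q^k and F_d is
-- the bracketed closed form: both sides satisfy the same recurrence (with forcing coming from level d - 1) and
-- agree at n = d - 1 and n = d. The three facts about F_d that this needs become polynomial identities once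
-- U_{(m+j)k} is written as a α^{kj} - b β^{kj} with a = w α^{km}, b = w β^{km}, and they are checked by
-- normalising both sides.

module Submission where

open import Level using (Level)
open import Algebra.Bundles using (CommutativeRing; RawRing)
open import Data.Nat as ℕ using (ℕ; zero; suc)
open import Data.Integer as ℤ using (ℤ; +_; -[1+_])
import Data.Integer.Properties as ℤ
import Data.Nat.Properties as ℕ
open import Data.Sign as Sign using ()
open import Data.Fin as Fin using (Fin)
open import Data.Vec using (Vec; []; _∷_; lookup; map)
open import Data.Vec.Properties using (lookup-map)
open import Data.Maybe using (Maybe; just; nothing)
open import Data.Product using (_,_)
open import Relation.Nullary using (yes; no)
open import Relation.Binary.PropositionalEquality as ≡ using (_≡_)
import Algebra.Solver.Ring.AlmostCommutativeRing as ACR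
open import Defs

module RingPolynomials {c ℓ : Level} (R : CommutativeRing c ℓ) where
  open CommutativeRing R hiding (zero)
  open Lucas R using (ι)
  open import Algebra.Properties.Ring ring
    using (-0#≈0#; -‿+-comm; -‿involutive; -‿distribˡ-*; -‿distribʳ-*)
  open import Relation.Binary.Reasoning.Setoid setoid

  ι-+ : ∀ m n → ι (m ℕ.+ n) ≈ ι m + ι n
  ι-+ zero    n = sym (+-identityˡ _)
  ι-+ (suc m) n = trans (+-congˡ (ι-+ m n)) (sym (+-assoc _ _ _))

  ι-* : ∀ m n → ι (m ℕ.* n) ≈ ι m * ι n
  ι-* zero    n = sym (zeroˡ _)
  ι-* (suc m) n = begin
    ι (n ℕ.+ m ℕ.* n)     ≈⟨ ι-+ n (m ℕ.* n) ⟩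
    ι n + ι (m ℕ.* n)     ≈⟨ +-cong (sym (*-identityˡ _)) (ι-* m n) ⟩
    1# * ι n + ι m * ι n  ≈⟨ distribʳ _ _ _ ⟨
    (1# + ι m) * ι n      ∎

  ι-suc-cancel : ∀ m n → ι (suc m) - ι (suc n) ≈ ι m - ι n
  ι-suc-cancel m n = begin
    (1# + ι m) - (1# + ι n)      ≈⟨ +-congˡ (-‿+-comm 1# (ι n)) ⟨
    (1# + ι m) + (- 1# - ι n)    ≈⟨ +-assoc _ _ _ ⟩
    1# + (ι m + (- 1# - ι n))    ≈⟨ +-congˡ (trans (sym (+-assoc _ _ _)) (+-congʳ (+-comm _ _))) ⟩
    1# + ((- 1# + ι m) - ι n)    ≈⟨ +-congˡ (+-assoc _ _ _) ⟩
    1# + (- 1# + (ι m - ι n))    ≈⟨ +-assoc _ _ _ ⟨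
    (1# - 1#) + (ι m - ι n)      ≈⟨ +-congʳ (-‿inverseʳ 1#) ⟩
    0# + (ι m - ι n)             ≈⟨ +-identityˡ _ ⟩
    ι m - ι n                    ∎

  -- ⟦ + n ⟧ℤ is ι n on the nose, so the solver's constants are definitionally the numerals of Defs.
  ⟦_⟧ℤ : ℤ → Carrier
  ⟦ + n      ⟧ℤ = ι n
  ⟦ -[1+ n ] ⟧ℤ = - ι (suc n)

  ⊖-homo : ∀ m n → ⟦ m ℤ.⊖ n ⟧ℤ ≈ ι m - ι n
  ⊖-homo m       zero    = sym (trans (+-congˡ -0#≈0#) (+-identityʳ _))
  ⊖-homo zero    (suc n) = sym (+-identityˡ _)
  ⊖-homo (suc m) (suc n) = begin
    ⟦ suc m ℤ.⊖ suc n ⟧ℤ ≡⟨ ≡.cong ⟦_⟧ℤ (ℤ.[1+m]⊖[1+n]≡m⊖n m n) ⟩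
    ⟦ m ℤ.⊖ n ⟧ℤ         ≈⟨ ⊖-homo m n ⟩
    ι m - ι n            ≈⟨ ι-suc-cancel m n ⟨
    ι (suc m) - ι (suc n) ∎

  +-homo : ∀ i j → ⟦ i ℤ.+ j ⟧ℤ ≈ ⟦ i ⟧ℤ + ⟦ j ⟧ℤ
  +-homo -[1+ m ] -[1+ n ] = begin
    - ι (suc (suc (m ℕ.+ n)))  ≡⟨ ≡.cong (λ t → - ι (suc t)) (ℕ.+-suc m n) ⟨
    - ι (suc m ℕ.+ suc n)      ≈⟨ -‿cong (ι-+ (suc m) (suc n)) ⟩
    - (ι (suc m) + ι (suc n))  ≈⟨ -‿+-comm _ _ ⟨
    - ι (suc m) - ι (suc n)    ∎
  +-homo -[1+ m ] (+ n)    = trans (⊖-homo n (suc m)) (+-comm _ _)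
  +-homo (+ m)    -[1+ n ] = ⊖-homo m (suc n)
  +-homo (+ m)    (+ n)    = ι-+ m n

  -‿homo : ∀ i → ⟦ ℤ.- i ⟧ℤ ≈ - ⟦ i ⟧ℤ
  -‿homo (+ zero)  = sym -0#≈0#
  -‿homo (+ suc n) = refl
  -‿homo -[1+ n ]  = sym (-‿involutive _)

  +◃-homo : ∀ n → ⟦ Sign.+ ℤ.◃ n ⟧ℤ ≈ ι n
  +◃-homo zero    = refl
  +◃-homo (suc n) = refl

  -◃-homo : ∀ n → ⟦ Sign.- ℤ.◃ n ⟧ℤ ≈ - ι n
  -◃-homo zero    = sym -0#≈0#
  -◃-homo (suc n) = refl

  *-homo : ∀ i j → ⟦ i ℤ.* j ⟧ℤ ≈ ⟦ i ⟧ℤ * ⟦ j ⟧ℤ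
  *-homo (+ m)    (+ n)    = trans (+◃-homo (m ℕ.* n)) (ι-* m n)
  *-homo (+ m)    -[1+ n ] = begin
    ⟦ Sign.- ℤ.◃ (m ℕ.* suc n) ⟧ℤ  ≈⟨ -◃-homo (m ℕ.* suc n) ⟩
    - ι (m ℕ.* suc n)              ≈⟨ -‿cong (ι-* m (suc n)) ⟩
    - (ι m * ι (suc n))            ≈⟨ -‿distribʳ-* _ _ ⟩
    ι m * - ι (suc n)              ∎
  *-homo -[1+ m ] (+ n)    = begin
    ⟦ Sign.- ℤ.◃ (suc m ℕ.* n) ⟧ℤ  ≈⟨ -◃-homo (suc m ℕ.* n) ⟩
    - ι (suc m ℕ.* n)              ≈⟨ -‿cong (ι-* (suc m) n) ⟩
    - (ι (suc m) * ι n)            ≈⟨ -‿distribˡ-* _ _ ⟩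
    - ι (suc m) * ι n              ∎
  *-homo -[1+ m ] -[1+ n ] = begin
    ι (suc m ℕ.* suc n)            ≈⟨ ι-* (suc m) (suc n) ⟩
    ι (suc m) * ι (suc n)          ≈⟨ -‿involutive _ ⟨
    - - (ι (suc m) * ι (suc n))    ≈⟨ -‿cong (-‿distribˡ-* _ _) ⟩
    - (- ι (suc m) * ι (suc n))    ≈⟨ -‿distribʳ-* _ _ ⟩
    - ι (suc m) * - ι (suc n)      ∎

  ℤ-rawRing : RawRing _ _
  ℤ-rawRing = record
    { Carrier = ℤ ; _≈_ = _≡_ ; _+_ = ℤ._+_ ; _*_ = ℤ._*_ ; -_ = ℤ.-_ ; 0# = + 0 ; 1# = + 1 }

  ℤ⟶R : ACR._-Raw-AlmostCommutative⟶_ ℤ-rawRing (ACR.fromCommutativeRing R)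
  ℤ⟶R = record
    { ⟦_⟧ = ⟦_⟧ℤ ; +-homo = +-homo ; *-homo = *-homo ; -‿homo = -‿homo
    ; 0-homo = refl ; 1-homo = +-identityʳ 1# }

  ≟-homo : ∀ i j → Maybe (⟦ i ⟧ℤ ≈ ⟦ j ⟧ℤ)
  ≟-homo i j with i ℤ.≟ j
  ... | yes ≡.refl = just refl
  ... | no _       = nothing

  open import Algebra.Solver.Ring ℤ-rawRing (ACR.fromCommutativeRing R) ℤ⟶R ≟-homo public

  open import Algebra.Properties.Semiring.Exp semiring using (_^_; ^-congˡ)

  ⟦⟧-cong : ∀ {n} (p : Polynomial n) {ρ ρ′ : Env n} →
            (∀ i → lookup ρ i ≈ lookup ρ′ i) → ⟦ p ⟧ ρ ≈ ⟦ p ⟧ ρ′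
  ⟦⟧-cong (op [+] p q) ρ≈ρ′ = +-cong (⟦⟧-cong p ρ≈ρ′) (⟦⟧-cong q ρ≈ρ′)
  ⟦⟧-cong (op [*] p q) ρ≈ρ′ = *-cong (⟦⟧-cong p ρ≈ρ′) (⟦⟧-cong q ρ≈ρ′)
  ⟦⟧-cong (con c)      ρ≈ρ′ = refl
  ⟦⟧-cong (var i)      ρ≈ρ′ = ρ≈ρ′ i
  ⟦⟧-cong (p :^ k)     ρ≈ρ′ = ^-congˡ k (⟦⟧-cong p ρ≈ρ′)
  ⟦⟧-cong (:- p)       ρ≈ρ′ = -‿cong (⟦⟧-cong p ρ≈ρ′)

  infixl 10 _⟨_⟩
  _⟨_⟩ : ∀ {m n} → Polynomial m → Vec (Polynomial n) m → Polynomial n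
  op o p q ⟨ σ ⟩ = op o (p ⟨ σ ⟩) (q ⟨ σ ⟩)
  con c    ⟨ σ ⟩ = con c
  var i    ⟨ σ ⟩ = lookup σ i
  (p :^ k) ⟨ σ ⟩ = p ⟨ σ ⟩ :^ k
  (:- p)   ⟨ σ ⟩ = :- (p ⟨ σ ⟩)

  ⟦⟨⟩⟧ : ∀ {m n} (p : Polynomial m) (σ : Vec (Polynomial n) m) ρ →
         ⟦ p ⟨ σ ⟩ ⟧ ρ ≡ ⟦ p ⟧ (map (λ s → ⟦ s ⟧ ρ) σ)
  ⟦⟨⟩⟧ (op o p q) σ ρ = ≡.cong₂ (sem o) (⟦⟨⟩⟧ p σ ρ) (⟦⟨⟩⟧ q σ ρ)
  ⟦⟨⟩⟧ (con c)    σ ρ = ≡.refl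
  ⟦⟨⟩⟧ (var i)    σ ρ = ≡.sym (lookup-map i (λ s → ⟦ s ⟧ ρ) σ)
  ⟦⟨⟩⟧ (p :^ k)   σ ρ = ≡.cong (_^ k) (⟦⟨⟩⟧ p σ ρ)
  ⟦⟨⟩⟧ (:- p)     σ ρ = ≡.cong -_ (⟦⟨⟩⟧ p σ ρ)

  infix 4 _≐_
  _≐_ : ∀ {n} → Polynomial n → Polynomial n → Set
  p ≐ q = normalise p ≡ normalise q

  ≐-sound : ∀ {n} (p q : Polynomial n) → p ≐ q → ∀ ρ → ⟦ p ⟧ ρ ≈ ⟦ q ⟧ ρ
  ≐-sound p q p≐q ρ = prove ρ p q (reflexive (≡.cong (λ nf → ⟦ nf ⟧N ρ) p≐q))

module Sequences {c ℓ : Level} (R : CommutativeRing c ℓ) where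
  open CommutativeRing R hiding (zero)
  open Lucas R
  open RingPolynomials R
  open import Relation.Binary.Reasoning.Setoid setoid
  open import Data.Nat using (_∸_)

  Σ≤-cong : ∀ n {f g : ℕ → Carrier} → (∀ j → f j ≈ g j) → Σ≤ n f ≈ Σ≤ n g
  Σ≤-cong zero    f≈g = f≈g 0
  Σ≤-cong (suc n) f≈g = +-cong (Σ≤-cong n f≈g) (f≈g (suc n))

  Σ≤-suc : ∀ n f → Σ≤ (suc n) f ≈ f 0 + Σ≤ n (λ j → f (suc j))
  Σ≤-suc zero    f = refl
  Σ≤-suc (suc n) f = trans (+-congʳ (Σ≤-suc n f)) (+-assoc _ _ _)

  Σ≤-linear : ∀ n a b f g → Σ≤ n (λ j → a * f j ⊖ b * g j) ≈ a * Σ≤ n f ⊖ b * Σ≤ n g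
  Σ≤-linear zero    a b f g = refl
  Σ≤-linear (suc n) a b f g = trans (+-congʳ (Σ≤-linear n a b f g))
    (solve 6 (λ a b F G f g → (a :* F :- b :* G) :+ (a :* f :- b :* g)
                             := a :* (F :+ f) :- b :* (G :+ g))
           refl a b (Σ≤ n f) (Σ≤ n g) (f (suc n)) (g (suc n)))

  infixl 7 _⋆_
  _⋆_ : (ℕ → Carrier) → (ℕ → Carrier) → ℕ → Carrier
  (f ⋆ g) n = Σ≤ n (λ j → f j * g (n ∸ j))

  module _ (f : ℕ → Carrier) (f₀≈0 : f 0 ≈ 0#) (g : ℕ → Carrier) where

    private
      f₀*≈0 : ∀ x → f 0 * x ≈ 0#
      f₀*≈0 x = trans (*-congʳ f₀≈0) (zeroˡ x)

    ⋆-zero : (f ⋆ g) 0 ≈ 0#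
    ⋆-zero = f₀*≈0 (g 0)

    ⋆-one : (f ⋆ g) 1 ≈ f 1 * g 0
    ⋆-one = trans (+-congʳ (f₀*≈0 (g 1))) (+-identityˡ _)

    ⋆-recurrence : ∀ {V q} → (∀ j → f (suc (suc j)) ≈ V * f (suc j) ⊖ q * f j) →
                   ∀ n → (f ⋆ g) (suc (suc n)) ≈ V * (f ⋆ g) (suc n) ⊖ q * (f ⋆ g) n + f 1 * g (suc n)
    ⋆-recurrence {V} {q} f-rec n = begin
      (f ⋆ g) (suc (suc n))
        ≈⟨ Σ≤-suc (suc n) H ⟩
      H 0 + Σ≤ (suc n) (λ j → H (suc j))
        ≈⟨ +-cong (f₀*≈0 _) (Σ≤-suc n (λ j → H (suc j))) ⟩
      0# + (f 1 * g (suc n) + Σ≤ n (λ j → H (suc (suc j))))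
        ≈⟨ +-congˡ (+-congˡ tail) ⟩
      0# + (f 1 * g (suc n) + (V * T ⊖ q * (f ⋆ g) n))
        ≈⟨ solve 4 (λ F V T Q → con (+ 0) :+ (F :+ (V :* T :- Q)) := V :* (con (+ 0) :+ T) :- Q :+ F)
                 refl (f 1 * g (suc n)) V T (q * (f ⋆ g) n) ⟩
      V * (0# + T) ⊖ q * (f ⋆ g) n + f 1 * g (suc n)
        ≈⟨ +-congʳ (+-congʳ (*-congˡ head)) ⟩
      V * (f ⋆ g) (suc n) ⊖ q * (f ⋆ g) n + f 1 * g (suc n)
        ∎
      where
        H : ℕ → Carrier
        H j = f j * g (suc (suc n) ∸ j)
        T : Carrier
        T = Σ≤ n (λ j → f (suc j) * g (n ∸ j))
        head : 0# + T ≈ (f ⋆ g) (suc n)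
        head = sym (trans (Σ≤-suc n (λ j → f j * g (suc n ∸ j))) (+-congʳ (f₀*≈0 _)))
        tail : Σ≤ n (λ j → H (suc (suc j))) ≈ V * T ⊖ q * (f ⋆ g) n
        tail = trans (Σ≤-cong n (λ j → trans (*-congʳ (f-rec j))
                       (solve 5 (λ V q F F′ G → (V :* F :- q :* F′) :* G := V :* (F :* G) :- q :* (F′ :* G))
                                refl V q (f (suc j)) (f j) (g (n ∸ j)))))
                     (Σ≤-linear n V q _ _)

  scale-recurrence : ∀ K V q X Y Z → K * (V * X ⊖ q * Y + Z) ≈ V * (K * X) ⊖ q * (K * Y) + K * Z
  scale-recurrence =
    solve 6 (λ K V q X Y Z → K :* (V :* X :- q :* Y :+ Z) := V :* (K :* X) :- q :* (K :* Y) :+ K :* Z) refl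

  recurrence-unique : ∀ {V q} n₀ (φ a b : ℕ → Carrier) →
    (∀ m → a (suc (suc (m ℕ.+ n₀))) ≈ V * a (suc (m ℕ.+ n₀)) ⊖ q * a (m ℕ.+ n₀) + φ m) →
    (∀ m → b (suc (suc (m ℕ.+ n₀))) ≈ V * b (suc (m ℕ.+ n₀)) ⊖ q * b (m ℕ.+ n₀) + φ m) →
    a n₀ ≈ b n₀ → a (suc n₀) ≈ b (suc n₀) → ∀ m → a (m ℕ.+ n₀) ≈ b (m ℕ.+ n₀)
  recurrence-unique {V} {q} n₀ φ a b a-rec b-rec a₀≈b₀ a₁≈b₁ = a≈b
    where
      a≈b : ∀ m → a (m ℕ.+ n₀) ≈ b (m ℕ.+ n₀)
      a≈b zero          = a₀≈b₀
      a≈b (suc zero)    = a₁≈b₁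
      a≈b (suc (suc m)) = begin
        a (suc (suc (m ℕ.+ n₀)))
          ≈⟨ a-rec m ⟩
        V * a (suc (m ℕ.+ n₀)) ⊖ q * a (m ℕ.+ n₀) + φ m
          ≈⟨ +-congʳ (+-cong (*-congˡ (a≈b (suc m))) (-‿cong (*-congˡ (a≈b m)))) ⟩
        V * b (suc (m ℕ.+ n₀)) ⊖ q * b (m ℕ.+ n₀) + φ m
          ≈⟨ b-rec m ⟨
        b (suc (suc (m ℕ.+ n₀)))
          ∎

  pow-inverse : ∀ {x y} → x * y ≈ 1# → ∀ r → pow x r * pow y r ≈ 1#
  pow-inverse x*y≈1 zero    = *-identityˡ 1#
  pow-inverse {x} {y} x*y≈1 (suc r) = begin
    x * pow x r * (y * pow y r)     ≈⟨ solve 4 (λ x y X Y → x :* X :* (y :* Y) := x :* y :* (X :* Y))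
                                             refl x y (pow x r) (pow y r) ⟩
    x * y * (pow x r * pow y r)     ≈⟨ *-cong x*y≈1 (pow-inverse x*y≈1 r) ⟩
    1# * 1#                         ≈⟨ *-identityˡ 1# ⟩
    1#                              ∎

module ClosedForms {c ℓ : Level} (R : CommutativeRing c ℓ) where
  open RingPolynomials R
  open import Data.Fin using (#_; toℕ; _↑ʳ_)
  open import Data.Vec using (tabulate)
  open import Data.Nat using (_∸_)

  -- A closed form for d summands is a polynomial in V, q, N, y₀, …, y_{d-1}, to be evaluated at
  -- V = V_k, q = q^k, N = n and y_i = U_{(n-i)k}.
  ClosedForm : ℕ → Set
  ClosedForm d = Polynomial (3 ℕ.+ d)

  κ : ∀ {n} → ℕ → Polynomial n
  κ t = con (+ t)

  V̂ q̂ N̂ : ∀ {d} → ClosedForm d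
  V̂ = var (# 0)
  q̂ = var (# 1)
  N̂ = var (# 2)

  ŷ : ∀ {d} → Fin d → ClosedForm d
  ŷ i = var (3 ↑ʳ i)

  closedForm₁ : ClosedForm 1
  closedForm₁ = ŷ (# 0)

  closedForm₂ : ClosedForm 2
  closedForm₂ = V̂ :* (N̂ :- κ 1) :* ŷ (# 0) :- κ 2 :* q̂ :* N̂ :* ŷ (# 1)

  closedForm₃ : ClosedForm 3
  closedForm₃ =
    V̂ :^ 2 :* (N̂ :- κ 1) :* (N̂ :- κ 2) :* ŷ (# 0)
    :- κ 2 :* q̂ :* V̂ :* (N̂ :- κ 2) :* (κ 2 :* N̂ :+ κ 1) :* ŷ (# 1)
    :+ κ 4 :* q̂ :^ 2 :* (N̂ :- κ 1) :* (N̂ :+ κ 1) :* ŷ (# 2)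

  closedForm₄ : ClosedForm 4
  closedForm₄ =
    V̂ :^ 3 :* (N̂ :- κ 1) :* (N̂ :- κ 2) :* (N̂ :- κ 3) :* ŷ (# 0)
    :- κ 6 :* q̂ :* V̂ :^ 2 :* (N̂ :- κ 2) :* (N̂ :- κ 3) :* (N̂ :+ κ 1) :* ŷ (# 1)
    :+ κ 12 :* q̂ :^ 2 :* V̂ :* (N̂ :- κ 3) :* (N̂ :^ 2 :+ N̂ :- κ 1) :* ŷ (# 2)
    :- κ 8 :* q̂ :^ 3 :* N̂ :* (N̂ :^ 2 :- κ 4) :* ŷ (# 3)

  closedForm₅ : ClosedForm 5
  closedForm₅ =
    V̂ :^ 4 :* (N̂ :- κ 1) :* (N̂ :- κ 2) :* (N̂ :- κ 3) :* (N̂ :- κ 4) :* ŷ (# 0)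
    :- κ 4 :* q̂ :* V̂ :^ 3 :* (N̂ :- κ 2) :* (N̂ :- κ 3) :* (N̂ :- κ 4) :* (κ 2 :* N̂ :+ κ 3) :* ŷ (# 1)
    :+ κ 12 :* q̂ :^ 2 :* V̂ :^ 2 :* (N̂ :- κ 3) :* (N̂ :- κ 4) :* (κ 2 :* N̂ :^ 2 :+ κ 4 :* N̂ :- κ 1) :* ŷ (# 2)
    :- κ 8 :* q̂ :^ 3 :* V̂ :* (N̂ :- κ 4) :* (κ 2 :* N̂ :+ κ 1) :* (κ 2 :* N̂ :^ 2 :+ κ 2 :* N̂ :- κ 9) :* ŷ (# 3)
    :+ κ 16 :* q̂ :^ 4 :* (N̂ :- κ 3) :* (N̂ :- κ 1) :* (N̂ :+ κ 1) :* (N̂ :+ κ 3) :* ŷ (# 4)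

  closedForm₆ : ClosedForm 6
  closedForm₆ =
    V̂ :^ 5 :* (N̂ :- κ 1) :* (N̂ :- κ 2) :* (N̂ :- κ 3) :* (N̂ :- κ 4) :* (N̂ :- κ 5) :* ŷ (# 0)
    :- κ 10 :* q̂ :* V̂ :^ 4 :* (N̂ :- κ 2) :* (N̂ :- κ 3) :* (N̂ :- κ 4) :* (N̂ :- κ 5) :* (N̂ :+ κ 2) :* ŷ (# 1)
    :+ κ 20 :* q̂ :^ 2 :* V̂ :^ 3 :* (N̂ :- κ 3) :* (N̂ :- κ 4) :* (N̂ :- κ 5) :* (κ 2 :* N̂ :^ 2 :+ κ 6 :* N̂ :+ κ 1) :* ŷ (# 2)
    :- κ 40 :* q̂ :^ 3 :* V̂ :^ 2 :* (N̂ :- κ 4) :* (N̂ :- κ 5) :* (N̂ :+ κ 1) :* (κ 2 :* N̂ :^ 2 :+ κ 4 :* N̂ :- κ 9) :* ŷ (# 3)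
    :+ κ 80 :* q̂ :^ 4 :* V̂ :* (N̂ :- κ 5) :* (N̂ :^ 4 :+ κ 2 :* N̂ :^ 3 :- κ 10 :* N̂ :^ 2 :- κ 11 :* N̂ :+ κ 9) :* ŷ (# 4)
    :- κ 32 :* q̂ :^ 5 :* N̂ :* (N̂ :- κ 4) :* (N̂ :- κ 2) :* (N̂ :+ κ 2) :* (N̂ :+ κ 4) :* ŷ (# 5)

  α̂ β̂ : ∀ {n} → Polynomial (2 ℕ.+ n)
  α̂ = var (# 0)
  β̂ = var (# 1)

  D̂ : ∀ {n} → Polynomial (2 ℕ.+ n)
  D̂ = (α̂ :+ β̂) :^ 2 :- κ 4 :* (α̂ :* β̂)

  â b̂ m̂ : Polynomial 5
  â = var (# 2)
  b̂ = var (# 3)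
  m̂ = var (# 4)

  -- The arguments of a closed form at n = m + t in terms of α̂ = α^k, β̂ = β^k, â = w α^{km}, b̂ = w β^{km}
  -- and m̂ = m, using U_{(n-i)k} = â α̂^{t-i} - b̂ β̂^{t-i} for i ≤ t.
  geometric : ∀ {d} → ℕ → Vec (Polynomial 5) (3 ℕ.+ d)
  geometric t = (α̂ :+ β̂) ∷ (α̂ :* β̂) ∷ (m̂ :+ κ t)
              ∷ tabulate (λ i → â :* α̂ :^ (t ∸ toℕ i) :- b̂ :* β̂ :^ (t ∸ toℕ i))

  ŵ : Polynomial 3
  ŵ = var (# 2)

  -- The case m = 0 of geometric, in the variables α^k, β^k and w.
  initial : Vec (Polynomial 3) 5
  initial = α̂ ∷ β̂ ∷ ŵ :* α̂ :^ 0 ∷ ŵ :* β̂ :^ 0 ∷ κ 0 ∷ []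

  recurrenceStep : ∀ {r} → ClosedForm (suc (suc r)) → ClosedForm (suc r) → Polynomial 5
  recurrenceStep {r} B G =
    (α̂ :+ β̂) :* B ⟨ geometric (2 ℕ.+ r) ⟩ :- α̂ :* β̂ :* B ⟨ geometric (1 ℕ.+ r) ⟩
    :+ κ (suc r) :* D̂ :* G ⟨ geometric (2 ℕ.+ r) ⟩

  Step : ∀ {r} → ClosedForm (suc (suc r)) → ClosedForm (suc r) → Set
  Step {r} B G = B ⟨ geometric (3 ℕ.+ r) ⟩ ≐ recurrenceStep B G

  Initial₀ : ∀ {r} → ClosedForm (suc (suc r)) → Set
  Initial₀ {r} B = B ⟨ geometric (suc r) ⟩ ⟨ initial ⟩ ≐ κ 0

  Initial₁ : ∀ {r} → ℕ → ClosedForm (suc (suc r)) → Set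
  Initial₁ {r} c B = B ⟨ geometric (2 ℕ.+ r) ⟩ ⟨ initial ⟩ ≐ κ c :* D̂ :^ suc r :* (ŵ :* (α̂ :- β̂))

module LucasSums {c ℓ : Level} (R : CommutativeRing c ℓ) (α β w : CommutativeRing.Carrier R) (k : ℕ) where
  open CommutativeRing R hiding (zero)
  open Lucas R
  open RingPolynomials R
  open Sequences R
  open ClosedForms R
  open import Algebra.Properties.CommutativeSemiring.Exp commutativeSemiring
    using (_^_; ^-homo-*; ^-assocʳ; ^-distrib-*; ^-congˡ)
  open import Relation.Binary.Reasoning.Setoid setoid
  open import Data.Nat using (_∸_; _≤_; _<_; s≤s)
  open import Data.Fin using (toℕ)
  import Data.Fin.Properties as Fin
  open import Data.Vec using (tabulate)
  open import Data.Vec.Properties using (lookup∘tabulate)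

  αᵏ βᵏ Vᵏ qᵏ Uᵏ D : Carrier
  αᵏ = pow α k
  βᵏ = pow β k
  Vᵏ = V α β k
  qᵏ = pow (Q α β) k
  Uᵏ = U α β w k
  D  = pow Vᵏ 2 ⊖ ι 4 * qᵏ

  f u : ℕ → Carrier
  f j = U α β w (k ℕ.* j)
  u j = U α β w (j ℕ.* k)

  S : ℕ → ℕ → Carrier
  S d n = s α β w d n k

  pow≡^ : ∀ x n → pow x n ≡ x ^ n
  pow≡^ x zero    = ≡.refl
  pow≡^ x (suc n) = ≡.cong (x *_) (pow≡^ x n)

  pow-*-assoc : ∀ x j → pow x (k ℕ.* j) ≈ pow x k ^ j
  pow-*-assoc x j = begin
    pow x (k ℕ.* j)  ≡⟨ pow≡^ x (k ℕ.* j) ⟩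
    x ^ (k ℕ.* j)    ≈⟨ ^-assocʳ x k j ⟨
    (x ^ k) ^ j      ≡⟨ ≡.cong (_^ j) (pow≡^ x k) ⟨
    pow x k ^ j      ∎

  qᵏ≈αᵏβᵏ : qᵏ ≈ αᵏ * βᵏ
  qᵏ≈αᵏβᵏ = begin
    pow (α * β) k    ≡⟨ pow≡^ (α * β) k ⟩
    (α * β) ^ k      ≈⟨ ^-distrib-* α β k ⟩
    α ^ k * β ^ k    ≡⟨ ≡.cong₂ _*_ (pow≡^ α k) (pow≡^ β k) ⟨
    αᵏ * βᵏ          ∎

  u≡f : ∀ j → u j ≡ f j
  u≡f j = ≡.cong (U α β w) (ℕ.*-comm j k)

  f-geometric : ∀ j → f j ≈ w * (αᵏ ^ j ⊖ βᵏ ^ j)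
  f-geometric j = *-congˡ (+-cong (pow-*-assoc α j) (-‿cong (pow-*-assoc β j)))

  f₀≈0 : f 0 ≈ 0#
  f₀≈0 = trans (f-geometric 0) (trans (*-congˡ (-‿inverseʳ 1#)) (zeroʳ w))

  f₁≈Uᵏ : f 1 ≈ Uᵏ
  f₁≈Uᵏ = reflexive (≡.cong (U α β w) (ℕ.*-identityʳ k))

  f-recurrence : ∀ j → f (suc (suc j)) ≈ Vᵏ * f (suc j) ⊖ qᵏ * f j
  f-recurrence j = begin
    f (suc (suc j))
      ≈⟨ f-geometric (suc (suc j)) ⟩
    w * (αᵏ * (αᵏ * αᵏ ^ j) ⊖ βᵏ * (βᵏ * βᵏ ^ j))
      ≈⟨ solve 5 (λ w a b A B → w :* (a :* (a :* A) :- b :* (b :* B))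
                               := (a :+ b) :* (w :* (a :* A :- b :* B)) :- a :* b :* (w :* (A :- B)))
               refl w αᵏ βᵏ (αᵏ ^ j) (βᵏ ^ j) ⟩
    Vᵏ * (w * (αᵏ * αᵏ ^ j ⊖ βᵏ * βᵏ ^ j)) ⊖ αᵏ * βᵏ * (w * (αᵏ ^ j ⊖ βᵏ ^ j))
      ≈⟨ +-cong (*-congˡ (f-geometric (suc j))) (-‿cong (*-cong qᵏ≈αᵏβᵏ (f-geometric j))) ⟨
    Vᵏ * f (suc j) ⊖ qᵏ * f j
      ∎

  s-recurrence : ∀ d n →
    S (suc d) (suc (suc n)) ≈ Vᵏ * S (suc d) (suc n) ⊖ qᵏ * S (suc d) n + Uᵏ * S d (suc n)
  s-recurrence d n = trans (⋆-recurrence f f₀≈0 (λ m → S d m) f-recurrence n) (+-congˡ (*-congʳ f₁≈Uᵏ))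

  s-vanishes : ∀ d n → n < d → S d n ≈ 0#
  s-vanishes (suc d) zero          _               = ⋆-zero f f₀≈0 (λ m → S d m)
  s-vanishes (suc d) (suc zero)    (s≤s 1≤d)       = begin
    S (suc d) 1          ≈⟨ ⋆-one f f₀≈0 (λ m → S d m) ⟩
    f 1 * S d 0          ≈⟨ *-congˡ (s-vanishes d 0 1≤d) ⟩
    f 1 * 0#             ≈⟨ zeroʳ _ ⟩
    0#                   ∎
  s-vanishes (suc d) (suc (suc n)) (s≤s 2+n≤d) = begin
    S (suc d) (suc (suc n))
      ≈⟨ s-recurrence d n ⟩
    Vᵏ * S (suc d) (suc n) ⊖ qᵏ * S (suc d) n + Uᵏ * S d (suc n)
      ≈⟨ +-cong (+-cong (*-congˡ (s-vanishes (suc d) (suc n) (ℕ.m<n⇒m<1+n 2+n≤d)))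
                        (-‿cong (*-congˡ (s-vanishes (suc d) n (ℕ.m<n⇒m<1+n (ℕ.<⇒≤ 2+n≤d))))))
                (*-congˡ (s-vanishes d (suc n) 2+n≤d)) ⟩
    Vᵏ * 0# ⊖ qᵏ * 0# + Uᵏ * 0#
      ≈⟨ solve 3 (λ V q U → V :* con (+ 0) :- q :* con (+ 0) :+ U :* con (+ 0) := con (+ 0))
               refl Vᵏ qᵏ Uᵏ ⟩
    0#  ∎

  s-diagonal : ∀ d → S d d ≈ pow Uᵏ d
  s-diagonal zero          = refl
  s-diagonal (suc zero)    = trans (⋆-one f f₀≈0 (λ m → S 0 m)) (*-congʳ f₁≈Uᵏ)
  s-diagonal (suc (suc d)) = begin
    S (suc (suc d)) (suc (suc d))
      ≈⟨ s-recurrence (suc d) d ⟩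
    Vᵏ * S (suc (suc d)) (suc d) ⊖ qᵏ * S (suc (suc d)) d + Uᵏ * S (suc d) (suc d)
      ≈⟨ +-cong (+-cong (*-congˡ (s-vanishes (suc (suc d)) (suc d) ℕ.≤-refl))
                        (-‿cong (*-congˡ (s-vanishes (suc (suc d)) d (ℕ.m<n⇒m<1+n (ℕ.n<1+n d))))))
                (*-congˡ (s-diagonal (suc d))) ⟩
    Vᵏ * 0# ⊖ qᵏ * 0# + Uᵏ * pow Uᵏ (suc d)
      ≈⟨ solve 4 (λ V q U P → V :* con (+ 0) :- q :* con (+ 0) :+ U :* P := U :* P)
               refl Vᵏ qᵏ Uᵏ (pow Uᵏ (suc d)) ⟩
    pow Uᵏ (suc (suc d))  ∎

  window : ∀ {d} → ℕ → Vec Carrier d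
  window n = tabulate (λ i → u (n ∸ toℕ i))

  closedFormAt : ∀ {d} → ClosedForm d → ℕ → Carrier
  closedFormAt B n = ⟦ B ⟧ (Vᵏ ∷ qᵏ ∷ ι n ∷ window n)

  geometricEnv : ℕ → Vec Carrier 5
  geometricEnv m = αᵏ ∷ βᵏ ∷ w * αᵏ ^ m ∷ w * βᵏ ^ m ∷ ι m ∷ []

  u-shift : ∀ m j → u (m ℕ.+ j) ≈ w * αᵏ ^ m * αᵏ ^ j ⊖ w * βᵏ ^ m * βᵏ ^ j
  u-shift m j = begin
    u (m ℕ.+ j)
      ≡⟨ u≡f (m ℕ.+ j) ⟩
    f (m ℕ.+ j)
      ≈⟨ f-geometric (m ℕ.+ j) ⟩
    w * (αᵏ ^ (m ℕ.+ j) ⊖ βᵏ ^ (m ℕ.+ j))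
      ≈⟨ *-congˡ (+-cong (^-homo-* αᵏ m j) (-‿cong (^-homo-* βᵏ m j))) ⟩
    w * (αᵏ ^ m * αᵏ ^ j ⊖ βᵏ ^ m * βᵏ ^ j)
      ≈⟨ solve 5 (λ w A a B b → w :* (A :* a :- B :* b) := w :* A :* a :- w :* B :* b)
               refl w (αᵏ ^ m) (αᵏ ^ j) (βᵏ ^ m) (βᵏ ^ j) ⟩
    w * αᵏ ^ m * αᵏ ^ j ⊖ w * βᵏ ^ m * βᵏ ^ j
      ∎

  closedForm-geometric : ∀ {d} (B : ClosedForm d) m t → d ≤ suc t →
                         closedFormAt B (m ℕ.+ t) ≈ ⟦ B ⟨ geometric t ⟩ ⟧ (geometricEnv m)
  closedForm-geometric {d} B m t d≤1+t = begin
    closedFormAt B (m ℕ.+ t)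
      ≈⟨ ⟦⟧-cong B (λ i → trans (entry i) (reflexive (≡.sym (lookup-map i ⟦_⟧ρ (geometric t))))) ⟩
    ⟦ B ⟧ (map ⟦_⟧ρ (geometric t))
      ≡⟨ ⟦⟨⟩⟧ B (geometric t) (geometricEnv m) ⟨
    ⟦ B ⟨ geometric t ⟩ ⟧ (geometricEnv m)
      ∎
    where
      ⟦_⟧ρ : Polynomial 5 → Carrier
      ⟦ p ⟧ρ = ⟦ p ⟧ (geometricEnv m)
      entry : ∀ i → lookup (Vᵏ ∷ qᵏ ∷ ι (m ℕ.+ t) ∷ window (m ℕ.+ t)) i
                    ≈ ⟦ lookup (geometric {d} t) i ⟧ρ
      entry Fin.zero                            = refl
      entry (Fin.suc Fin.zero)                  = qᵏ≈αᵏβᵏ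
      entry (Fin.suc (Fin.suc Fin.zero))        = ι-+ m t
      entry (Fin.suc (Fin.suc (Fin.suc i)))     = begin
        lookup (window (m ℕ.+ t)) i          ≡⟨ lookup∘tabulate _ i ⟩
        u ((m ℕ.+ t) ∸ toℕ i)                ≡⟨ ≡.cong u (ℕ.+-∸-assoc m i≤t) ⟩
        u (m ℕ.+ (t ∸ toℕ i))                ≈⟨ u-shift m (t ∸ toℕ i) ⟩
        w * αᵏ ^ m * αᵏ ^ (t ∸ toℕ i) ⊖ w * βᵏ ^ m * βᵏ ^ (t ∸ toℕ i)
                                             ≡⟨ ≡.cong ⟦_⟧ρ (lookup∘tabulate _ i) ⟨
        ⟦ lookup (geometric {d} t) (Fin.suc (Fin.suc (Fin.suc i))) ⟧ρ ∎
        where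
          i≤t : toℕ i ≤ t
          i≤t = ℕ.≤-pred (ℕ.≤-trans (Fin.toℕ<n i) d≤1+t)

  D̂-eval : ∀ {n} (ρ : Vec Carrier n) → ⟦ D̂ ⟧ (αᵏ ∷ βᵏ ∷ ρ) ≈ D
  D̂-eval ρ = +-congˡ (-‿cong (*-congˡ (sym qᵏ≈αᵏβᵏ)))

  closedForm-step : ∀ {r} (B : ClosedForm (suc (suc r))) (G : ClosedForm (suc r)) → Step B G → ∀ m →
    closedFormAt B (m ℕ.+ suc (suc (suc r)))
      ≈ Vᵏ * closedFormAt B (m ℕ.+ suc (suc r)) ⊖ qᵏ * closedFormAt B (m ℕ.+ suc r)
        + ι (suc r) * D * closedFormAt G (m ℕ.+ suc (suc r))
  closedForm-step {r} B G step m = begin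
    closedFormAt B (m ℕ.+ suc (suc (suc r)))
      ≈⟨ closedForm-geometric B m (3 ℕ.+ r) (ℕ.m≤n⇒m≤1+n (ℕ.n≤1+n _)) ⟩
    ⟦ B ⟨ geometric (3 ℕ.+ r) ⟩ ⟧ ρ
      ≈⟨ ≐-sound (B ⟨ geometric (3 ℕ.+ r) ⟩) (recurrenceStep B G) step ρ ⟩
    Vᵏ * ⟦ B ⟨ geometric (2 ℕ.+ r) ⟩ ⟧ ρ ⊖ αᵏ * βᵏ * ⟦ B ⟨ geometric (1 ℕ.+ r) ⟩ ⟧ ρ
      + ι (suc r) * ⟦ D̂ ⟧ ρ * ⟦ G ⟨ geometric (2 ℕ.+ r) ⟩ ⟧ ρ
      ≈⟨ +-cong (+-cong (*-congˡ (closedForm-geometric B m (2 ℕ.+ r) (ℕ.n≤1+n _)))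
                        (-‿cong (*-cong qᵏ≈αᵏβᵏ (closedForm-geometric B m (1 ℕ.+ r) ℕ.≤-refl))))
                (*-cong (*-congˡ (sym (D̂-eval (w * αᵏ ^ m ∷ w * βᵏ ^ m ∷ ι m ∷ []))))
                        (closedForm-geometric G m (2 ℕ.+ r) (ℕ.m≤n⇒m≤1+n (ℕ.n≤1+n _)))) ⟨
    Vᵏ * closedFormAt B (m ℕ.+ suc (suc r)) ⊖ qᵏ * closedFormAt B (m ℕ.+ suc r)
      + ι (suc r) * D * closedFormAt G (m ℕ.+ suc (suc r))
      ∎
    where ρ = geometricEnv m

  initialEnv : Vec Carrier 3
  initialEnv = αᵏ ∷ βᵏ ∷ w ∷ []

  closedForm-initial₀ : ∀ {r} (B : ClosedForm (suc (suc r))) → Initial₀ B → closedFormAt B (suc r) ≈ 0#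
  closedForm-initial₀ {r} B init = begin
    closedFormAt B (suc r)
      ≈⟨ closedForm-geometric B 0 (suc r) ℕ.≤-refl ⟩
    ⟦ B ⟨ geometric (suc r) ⟩ ⟧ (geometricEnv 0)
      ≡⟨ ⟦⟨⟩⟧ (B ⟨ geometric (suc r) ⟩) initial initialEnv ⟨
    ⟦ B ⟨ geometric (suc r) ⟩ ⟨ initial ⟩ ⟧ initialEnv
      ≈⟨ ≐-sound (B ⟨ geometric (suc r) ⟩ ⟨ initial ⟩) (κ 0) init initialEnv ⟩
    0#
      ∎

  closedForm-initial₁ : ∀ {r c} (B : ClosedForm (suc (suc r))) → Initial₁ c B →
                        closedFormAt B (suc (suc r)) ≈ ι c * pow D (suc r) * Uᵏ
  closedForm-initial₁ {r} {c} B init = begin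
    closedFormAt B (suc (suc r))
      ≈⟨ closedForm-geometric B 0 (suc (suc r)) (ℕ.n≤1+n _) ⟩
    ⟦ B ⟨ geometric (2 ℕ.+ r) ⟩ ⟧ (geometricEnv 0)
      ≡⟨ ⟦⟨⟩⟧ (B ⟨ geometric (2 ℕ.+ r) ⟩) initial initialEnv ⟨
    ⟦ B ⟨ geometric (2 ℕ.+ r) ⟩ ⟨ initial ⟩ ⟧ initialEnv
      ≈⟨ ≐-sound (B ⟨ geometric (2 ℕ.+ r) ⟩ ⟨ initial ⟩) (κ c :* D̂ :^ suc r :* (ŵ :* (α̂ :- β̂)))
                 init initialEnv ⟩
    ι c * ⟦ D̂ ⟧ initialEnv ^ suc r * Uᵏ
      ≈⟨ *-congʳ (*-congˡ (^-congˡ (suc r) (D̂-eval (w ∷ [])))) ⟩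
    ι c * D ^ suc r * Uᵏ
      ≡⟨ ≡.cong (λ x → ι c * x * Uᵏ) (pow≡^ D (suc r)) ⟨
    ι c * pow D (suc r) * Uᵏ
      ∎

  scaledSum : ℕ → ℕ → ℕ → Carrier
  scaledSum r c n = ι c * pow D r * S (suc r) n

  SumClosedForm : ∀ r → ℕ → ClosedForm (suc r) → Set ℓ
  SumClosedForm r c B = ∀ m → scaledSum r c (m ℕ.+ r) ≈ pow Uᵏ r * closedFormAt B (m ℕ.+ r)

  forcing : ∀ r → ClosedForm (suc r) → ℕ → Carrier
  forcing r G m = pow Uᵏ (suc r) * (ι (suc r) * D * closedFormAt G (m ℕ.+ suc (suc r)))

  +-suc² : ∀ m n → m ℕ.+ suc (suc n) ≡ suc (suc (m ℕ.+ n))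
  +-suc² m n = ≡.trans (ℕ.+-suc m (suc n)) (≡.cong suc (ℕ.+-suc m n))

  scaledSum-recurrence : ∀ {r} c (G : ClosedForm (suc r)) → SumClosedForm r c G → ∀ m →
    let n = m ℕ.+ suc r; scaled = scaledSum (suc r) (c ℕ.* suc r) in
    scaled (suc (suc n)) ≈ Vᵏ * scaled (suc n) ⊖ qᵏ * scaled n + forcing r G m
  scaledSum-recurrence {r} c G G-closed m = begin
    K * S (suc (suc r)) (suc (suc n))
      ≈⟨ *-congˡ (s-recurrence (suc r) n) ⟩
    K * (Vᵏ * S (suc (suc r)) (suc n) ⊖ qᵏ * S (suc (suc r)) n + Uᵏ * S (suc r) (suc n))
      ≈⟨ scale-recurrence K Vᵏ qᵏ _ _ _ ⟩
    H + K * (Uᵏ * S (suc r) (suc n))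
      ≡⟨ ≡.cong (λ j → H + K * (Uᵏ * S (suc r) (suc j))) (ℕ.+-suc m r) ⟩
    H + K * (Uᵏ * X)
      ≈⟨ +-congˡ (*-congʳ (*-congʳ (ι-* c (suc r)))) ⟩
    H + ι c * ι (suc r) * pow D (suc r) * (Uᵏ * X)
      ≈⟨ +-congˡ (solve 6 (λ C s D Dʳ U X → C :* s :* (D :* Dʳ) :* (U :* X) := U :* s :* D :* (C :* Dʳ :* X))
                         refl (ι c) (ι (suc r)) D (pow D r) Uᵏ X) ⟩
    H + Uᵏ * ι (suc r) * D * scaledSum r c (suc (suc m) ℕ.+ r)
      ≈⟨ +-congˡ (*-congˡ (G-closed (suc (suc m)))) ⟩
    H + Uᵏ * ι (suc r) * D * (pow Uᵏ r * Y)
      ≈⟨ +-congˡ (solve 5 (λ U s D Uʳ Y → U :* s :* D :* (Uʳ :* Y) := U :* Uʳ :* (s :* D :* Y))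
                         refl Uᵏ (ι (suc r)) D (pow Uᵏ r) Y) ⟩
    H + pow Uᵏ (suc r) * (ι (suc r) * D * Y)
      ≡⟨ ≡.cong (λ j → H + pow Uᵏ (suc r) * (ι (suc r) * D * closedFormAt G j)) (+-suc² m r) ⟨
    H + forcing r G m
      ∎
    where
      n = m ℕ.+ suc r
      K = ι (c ℕ.* suc r) * pow D (suc r)
      H = Vᵏ * (K * S (suc (suc r)) (suc n)) ⊖ qᵏ * (K * S (suc (suc r)) n)
      X = S (suc r) (suc (suc m) ℕ.+ r)
      Y = closedFormAt G (suc (suc m) ℕ.+ r)

  closedForm-recurrence : ∀ {r} (B : ClosedForm (suc (suc r))) (G : ClosedForm (suc r)) → Step B G → ∀ m →
    let n = m ℕ.+ suc r; scaled = λ j → pow Uᵏ (suc r) * closedFormAt B j in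
    scaled (suc (suc n)) ≈ Vᵏ * scaled (suc n) ⊖ qᵏ * scaled n + forcing r G m
  closedForm-recurrence {r} B G step m = begin
    Uʳ⁺¹ * closedFormAt B (suc (suc (m ℕ.+ suc r)))
      ≡⟨ ≡.cong (λ n → Uʳ⁺¹ * closedFormAt B n) (+-suc² m (suc r)) ⟨
    Uʳ⁺¹ * closedFormAt B (m ℕ.+ suc (suc (suc r)))
      ≈⟨ *-congˡ (closedForm-step B G step m) ⟩
    Uʳ⁺¹ * (Vᵏ * closedFormAt B (m ℕ.+ suc (suc r)) ⊖ qᵏ * closedFormAt B (m ℕ.+ suc r)
            + ι (suc r) * D * closedFormAt G (m ℕ.+ suc (suc r)))
      ≈⟨ scale-recurrence Uʳ⁺¹ Vᵏ qᵏ _ _ _ ⟩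
    Vᵏ * b (m ℕ.+ suc (suc r)) ⊖ qᵏ * b (m ℕ.+ suc r) + forcing r G m
      ≡⟨ ≡.cong (λ n → Vᵏ * b n ⊖ qᵏ * b (m ℕ.+ suc r) + forcing r G m) (ℕ.+-suc m (suc r)) ⟩
    Vᵏ * b (suc (m ℕ.+ suc r)) ⊖ qᵏ * b (m ℕ.+ suc r) + forcing r G m
      ∎
    where
      Uʳ⁺¹ = pow Uᵏ (suc r)
      b = λ n → Uʳ⁺¹ * closedFormAt B n

  closedForm-suc : ∀ {r} c (G : ClosedForm (suc r)) (B : ClosedForm (suc (suc r))) →
    SumClosedForm r c G → Initial₀ B → Initial₁ (c ℕ.* suc r) B → Step B G →
    SumClosedForm (suc r) (c ℕ.* suc r) B
  closedForm-suc {r} c G B G-closed init₀ init₁ step =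
    recurrence-unique (suc r) (forcing r G) (scaledSum (suc r) (c ℕ.* suc r)) (λ n → Uʳ⁺¹ * closedFormAt B n)
      (scaledSum-recurrence c G G-closed) (closedForm-recurrence B G step) at-d-1 at-d
    where
      K Uʳ⁺¹ : Carrier
      K = ι (c ℕ.* suc r) * pow D (suc r)
      Uʳ⁺¹ = pow Uᵏ (suc r)

      at-d-1 : K * S (suc (suc r)) (suc r) ≈ Uʳ⁺¹ * closedFormAt B (suc r)
      at-d-1 = begin
        K * S (suc (suc r)) (suc r)  ≈⟨ *-congˡ (s-vanishes (suc (suc r)) (suc r) ℕ.≤-refl) ⟩
        K * 0#                       ≈⟨ zeroʳ K ⟩
        0#                           ≈⟨ zeroʳ Uʳ⁺¹ ⟨
        Uʳ⁺¹ * 0#                    ≈⟨ *-congˡ (closedForm-initial₀ B init₀) ⟨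
        Uʳ⁺¹ * closedFormAt B (suc r) ∎

      at-d : K * S (suc (suc r)) (suc (suc r)) ≈ Uʳ⁺¹ * closedFormAt B (suc (suc r))
      at-d = begin
        K * S (suc (suc r)) (suc (suc r))  ≈⟨ *-congˡ (s-diagonal (suc (suc r))) ⟩
        K * (Uᵏ * Uʳ⁺¹)                    ≈⟨ solve 3 (λ K U P → K :* (U :* P) := P :* (K :* U))
                                                       refl K Uᵏ Uʳ⁺¹ ⟩
        Uʳ⁺¹ * (K * Uᵏ)                    ≈⟨ *-congˡ (closedForm-initial₁ B init₁) ⟨
        Uʳ⁺¹ * closedFormAt B (suc (suc r)) ∎

  s₁≈f : ∀ m → S 1 (m ℕ.+ 0) ≈ f (m ℕ.+ 0)
  s₁≈f = recurrence-unique 0 (λ _ → Uᵏ * 0#) (S 1) f (λ m → s-recurrence 0 (m ℕ.+ 0)) f-rec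
           (trans (⋆-zero f f₀≈0 (S 0)) (sym f₀≈0))
           (trans (⋆-one f f₀≈0 (S 0)) (*-identityʳ (f 1)))
    where
      f-rec : ∀ m → f (suc (suc (m ℕ.+ 0))) ≈ Vᵏ * f (suc (m ℕ.+ 0)) ⊖ qᵏ * f (m ℕ.+ 0) + Uᵏ * 0#
      f-rec m = trans (f-recurrence (m ℕ.+ 0)) (sym (trans (+-congˡ (zeroʳ Uᵏ)) (+-identityʳ _)))

  sumClosedForm₁ : SumClosedForm 0 1 closedForm₁
  sumClosedForm₁ m = begin
    ι 1 * pow D 0 * S 1 (m ℕ.+ 0)   ≈⟨ solve 2 (λ D X → κ 1 :* D :^ 0 :* X := X) refl D (S 1 (m ℕ.+ 0)) ⟩
    S 1 (m ℕ.+ 0)                    ≈⟨ s₁≈f m ⟩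
    f (m ℕ.+ 0)                      ≡⟨ u≡f (m ℕ.+ 0) ⟨
    u (m ℕ.+ 0)                      ≈⟨ *-identityˡ _ ⟨
    pow Uᵏ 0 * u (m ℕ.+ 0)          ∎

  sumClosedForm₂ : SumClosedForm 1 1 closedForm₂
  sumClosedForm₂ = closedForm-suc 1 closedForm₁ closedForm₂ sumClosedForm₁ ≡.refl ≡.refl ≡.refl

  sumClosedForm₃ : SumClosedForm 2 2 closedForm₃
  sumClosedForm₃ = closedForm-suc 1 closedForm₂ closedForm₃ sumClosedForm₂ ≡.refl ≡.refl ≡.refl

  sumClosedForm₄ : SumClosedForm 3 6 closedForm₄
  sumClosedForm₄ = closedForm-suc 2 closedForm₃ closedForm₄ sumClosedForm₃ ≡.refl ≡.refl ≡.refl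

  sumClosedForm₅ : SumClosedForm 4 24 closedForm₅
  sumClosedForm₅ = closedForm-suc 6 closedForm₄ closedForm₅ sumClosedForm₄ ≡.refl ≡.refl ≡.refl

  sumClosedForm₆ : SumClosedForm 5 120 closedForm₆
  sumClosedForm₆ = closedForm-suc 24 closedForm₅ closedForm₆ sumClosedForm₅ ≡.refl ≡.refl ≡.refl

  sum-formula : ∀ {r} c {i e} (B : ClosedForm (suc r)) → SumClosedForm r c B →
                i * ι c ≈ 1# → e * D ≈ 1# →
                ∀ n → r ≤ n → S (suc r) n ≈ pow Uᵏ r * i * pow e r * closedFormAt B n
  sum-formula {r} c {i} {e} B B-closed i*c≈1 e*D≈1 n r≤n = begin
    X
      ≈⟨ *-identityˡ X ⟨
    1# * X
      ≈⟨ *-congʳ (trans (*-cong i*c≈1 (pow-inverse e*D≈1 r)) (*-identityˡ 1#)) ⟨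
    i * ι c * (pow e r * pow D r) * X
      ≈⟨ solve 5 (λ i C E Dʳ X → i :* C :* (E :* Dʳ) :* X := i :* E :* (C :* Dʳ :* X))
               refl i (ι c) (pow e r) (pow D r) X ⟩
    i * pow e r * (ι c * pow D r * X)
      ≈⟨ *-congˡ scaled ⟩
    i * pow e r * (pow Uᵏ r * Y)
      ≈⟨ solve 4 (λ i E Uʳ Y → i :* E :* (Uʳ :* Y) := Uʳ :* i :* E :* Y)
               refl i (pow e r) (pow Uᵏ r) Y ⟩
    pow Uᵏ r * i * pow e r * Y
      ∎
    where
      X = S (suc r) n
      Y = closedFormAt B n
      scaled : scaledSum r c n ≈ pow Uᵏ r * Y
      scaled = ≡.subst (λ n → scaledSum r c n ≈ pow Uᵏ r * closedFormAt B n)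
                       (ℕ.m∸n+n≡m r≤n) (B-closed (n ∸ r))

mainTheorem5 : ∀ {c ℓ : Level} (R : CommutativeRing c ℓ) → Lucas.Theorem5 R
mainTheorem5 R α β w _ k _ e e*D≈1 i6 i24 i120 i6*6≈1 i24*24≈1 i120*120≈1 =
    sum-formula 6 closedForm₄ sumClosedForm₄ i6*6≈1 e*D≈1
  , sum-formula 24 closedForm₅ sumClosedForm₅ i24*24≈1 e*D≈1
  , sum-formula 120 closedForm₆ sumClosedForm₆ i120*120≈1 e*D≈1
  where
    open ClosedForms R
    open LucasSums R α β w k
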